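{- Let $G$ be a finite, simple, connected graph and $\Gamma(G)$ its clique graph. If $\Gamma(G)$ is a tree, then $\mathrm{diam}(G)-1=\mathrm{diam}(\Gamma(G))$.
   Context: A clique is a nonempty vertex subset inducing a complete graph; a maximal clique is one maximal under inclusion. The clique graph $\Gamma(G)$ has as vertices the maximal cliques of $G$, with two maximal cliques $H_1,H_2$ adjacent iff $H_1\neq H_2$ and $H_1\cap H_2\neq\emptyset$. $\mathrm{diam}$ denotes the diameter (maximum graph distance between two vertices). -}

module Defs where

open import Data.Nat using (ℕ; zero; suc; _≤_)
open import Data.Bool using (Bool; true; false)
open import Data.Fin using (Fin)
open import Data.Fin.Subset using (Subset; _∈_; _⊆_; _∩_; Nonempty)
open import Data.List using (List; []; _∷_; _++_; [_]; length)
open import Data.List.Relation.Unary.Unique.Propositional using (Unique)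
open import Data.Product using (Σ; ∃; _×_; _,_)
open import Data.Unit using (⊤)
open import Relation.Nullary using (¬_)
open import Relation.Binary.PropositionalEquality using (_≡_; _≢_)

record SimpleGraph : Set where
  field
    n       : ℕ
    adj     : Fin n → Fin n → Bool
    symm    : ∀ u v → adj u v ≡ adj v u
    irrefl  : ∀ u → adj u u ≡ false

  Adj : Fin n → Fin n → Set
  Adj u v = adj u v ≡ true

open SimpleGraph public

-- General graphs: a carrier type V, a predicate singling out the
-- vertices, and an adjacency relation.  (Used uniformly for G and for
-- its clique graph, whose vertices are the subsets that are maximal
-- cliques.)

record Graph : Set₁ where
  field
    V   : Set
    Vtx : V → Set
    E   : V → V → Set

open Graph public

module _ (Γ : Graph) where

  data Walk : V Γ → V Γ → ℕ → Set where
    nil  : ∀ {u} → Vtx Γ u → Walk u u 0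
    cons : ∀ {u w v k} → E Γ u w → Walk w v k → Walk u v (suc k)

  Connected : Set
  Connected = (Σ (V Γ) λ u → Vtx Γ u)
            × (∀ u v → Vtx Γ u → Vtx Γ v → Σ ℕ λ k → Walk u v k)

  IsDist : V Γ → V Γ → ℕ → Set
  IsDist u v d = Walk u v d × (∀ k → Walk u v k → d ≤ k)

  IsDiam : ℕ → Set
  IsDiam D =
      (∀ u v → Vtx Γ u → Vtx Γ v → Σ ℕ λ d → IsDist u v d × d ≤ D)
    × (Σ (V Γ) λ u → Σ (V Γ) λ v → Vtx Γ u × Vtx Γ v × IsDist u v D)

  Chain : List (V Γ) → Set
  Chain []           = ⊤
  Chain (x ∷ [])     = ⊤
  Chain (x ∷ y ∷ xs) = E Γ x y × Chain (y ∷ xs)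

  HasCycle : Set
  HasCycle = Σ (V Γ) λ x → Σ (List (V Γ)) λ rest →
               2 ≤ length rest × Unique (x ∷ rest) × Vtx Γ x
             × Chain (x ∷ rest ++ [ x ])

  IsTree : Set
  IsTree = Connected × ¬ HasCycle

toGraph : SimpleGraph → Graph
toGraph G = record { V = Fin (n G) ; Vtx = λ _ → ⊤ ; E = Adj G }

IsClique : (G : SimpleGraph) → Subset (n G) → Set
IsClique G S = Nonempty S × (∀ x y → x ∈ S → y ∈ S → x ≢ y → Adj G x y)

IsMaximalClique : (G : SimpleGraph) → Subset (n G) → Set
IsMaximalClique G S = IsClique G S × (∀ T → IsClique G T → S ⊆ T → T ≡ S)

cliqueGraph : SimpleGraph → Graph
cliqueGraph G = record
  { V   = Subset (n G)
  ; Vtx = IsMaximalClique G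
  ; E   = λ H₁ H₂ → IsMaximalClique G H₁ × IsMaximalClique G H₂
                  × H₁ ≢ H₂ × Nonempty (H₁ ∩ H₂)
  }

{-# OPTIONS --safe #-}
-- Every edge of G lies in a maximal clique, and consecutive cliques of a walk in Γ(G) share a
-- vertex, so walks in G and in Γ(G) translate into each other with lengths differing by at most
-- one.  Taking cliques through two vertices at distance diam G gives diam Γ(G) ≥ diam G − 1.
-- Conversely, let A ≠ B be cliques at distance d, u ∈ A outside the second clique of a geodesic
-- from A to B, and v ∈ B outside the second clique of a geodesic from B to A.  Paths in the
-- tree Γ(G) are unique, so a clique through u other than A is a neighbour of A off the geodesic
-- and hence at distance d + 1 from B; likewise for v.  Thus every walk from u to v in G has
-- length at least d + 1, and diam Γ(G) ≤ diam G − 1.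
module Submission where

open import Defs
open import Data.Nat using (ℕ; zero; suc; _+_; _∸_; _≤_; _<_; z≤n; s≤s)
open import Data.Nat.Properties
  using (≤-refl; ≤-trans; ≤-reflexive; ≤-antisym; ≤-pred; ≤-totalOrder; n≤1+n; m≤n⇒m≤1+n; m<n⇒m<1+n; ∸-monoˡ-≤; m≤n+m; +-suc; +-identityʳ; +-monoˡ-≤; <⇒≱)
open import Data.Nat.Induction using (<-wellFounded)
open import Induction.WellFounded using (Acc; acc)
open import Data.Bool using (true) renaming (_≟_ to _≟ᵇ_)
open import Data.Fin using (Fin) renaming (_≟_ to _≟ᶠ_)
open import Data.Fin.Properties using (any?; all?)
open import Data.Fin.Subset using (Subset; _∈_; _∉_; _⊆_; _⊂_; _∩_; _∪_; ⁅_⁆; ∣_∣)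
open import Data.Fin.Subset.Properties
  using (_∈?_; _⊂?_; nonempty?; anySubset?; x∈p∩q⁺; x∈p∩q⁻; x∈p∪q⁺; x∈p∪q⁻; x∈⁅x⁆; x∈⁅y⁆⇒x≡y; ⊆-antisym; p⊂q⇒∣p∣<∣q∣; ∣p∣≤n)
open import Data.Vec.Properties using (≡-dec)
open import Data.List using (List; []; _∷_; _++_; [_]; length; allFin)
open import Data.List.Properties using (++-assoc; length-++-≤ˡ; ∷-injectiveˡ)
open import Data.List.Relation.Unary.All as All using ([]; _∷_)
open import Data.List.Relation.Unary.All.Properties using (¬Any⇒All¬; ++⁻ˡ; ++⁻ʳ)
open import Data.List.Relation.Unary.Any using (here; there)
open import Data.List.Relation.Unary.AllPairs using ([]; _∷_)
open import Data.List.Relation.Unary.Unique.Propositional using (Unique)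
import Data.List.Relation.Unary.Unique.Propositional.Properties as Unique
open import Data.List.Relation.Binary.Disjoint.Propositional using (Disjoint)
open import Data.List.Membership.Propositional using () renaming (_∈_ to _∈ₗ_; _∉_ to _∉ₗ_)
open import Data.List.Membership.Propositional.Properties using (∈-∃++; ∈-++⁺ˡ; ∈-allFin)
import Data.List.Membership.DecPropositional as DecMembership
open import Data.List.Extrema ≤-totalOrder using (argmax; f[xs]≤f[argmax])
open import Data.Product using (Σ; ∃; ∃₂; _×_; _,_; proj₁; proj₂)
open import Data.Sum using (_⊎_; inj₁; inj₂)
open import Data.Empty using (⊥-elim)
open import Data.Unit using (tt)
open import Function using (_∘_; id)
open import Relation.Nullary using (¬_; Dec; yes; no)
open import Relation.Nullary.Decidable using (_×-dec_; _→-dec_; ¬?; map′; decidable-stable)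
open import Relation.Unary using (Decidable)
open import Relation.Binary.Definitions using (DecidableEquality)
open import Relation.Binary.PropositionalEquality using (_≡_; _≢_; refl; sym; trans; cong; subst; module ≡-Reasoning)

least-witness : {P : ℕ → Set} → Decidable P → ∀ {k} → P k → ∃ λ d → P d × (∀ {j} → P j → d ≤ j)
least-witness P? {zero} p₀ = 0 , p₀ , λ _ → z≤n
least-witness {P} P? {suc k} pₖ with P? 0
... | yes p₀ = 0 , p₀ , λ _ → z≤n
... | no ¬p₀ with least-witness (P? ∘ suc) pₖ
...   | d , p , least = suc d , p , above
  where
  above : ∀ {j} → P j → suc d ≤ j
  above {zero}  p₀ = ⊥-elim (¬p₀ p₀)
  above {suc j} pⱼ = s≤s (least pⱼ)

argmax-Fin : ∀ {m} (f : Fin m → ℕ) → Fin m → ∃ λ i → ∀ j → f j ≤ f i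
argmax-Fin f i₀ = argmax f i₀ (allFin _) , λ j → All.lookup (f[xs]≤f[argmax] i₀ (allFin _)) (∈-allFin j)

maximum-pair : ∀ {m} (f : Fin m → Fin m → ℕ) → Fin m → ∃₂ λ u v → ∀ u′ v′ → f u′ v′ ≤ f u v
maximum-pair {m} f i₀ = u , v u , λ u′ v′ → ≤-trans (proj₂ (argmax-Fin (f u′) i₀) v′) (proj₂ (argmax-Fin g i₀) u′)
  where
  v : Fin m → Fin m
  v u′ = proj₁ (argmax-Fin (f u′) i₀)
  g : Fin m → ℕ
  g u′ = f u′ (v u′)
  u : Fin m
  u = proj₁ (argmax-Fin g i₀)

final : {A : Set} → A → List A → A
final x []       = x
final x (y ∷ ys) = final y ys

final∈ : {A : Set} (x : A) (ys : List A) → final x ys ∈ₗ x ∷ ys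
final∈ x []       = here refl
final∈ x (y ∷ ys) = there (final∈ y ys)

Unique-++-∷⁻ : {A : Set} (xs : List A) {y : A} {ys : List A} → Unique (xs ++ y ∷ ys) → Unique xs × y ∉ₗ xs
Unique-++-∷⁻ []       _            = [] , λ ()
Unique-++-∷⁻ (x ∷ xs) (x∉ ∷ unique) with Unique-++-∷⁻ xs unique
... | unique-xs , y∉xs = ++⁻ˡ xs x∉ ∷ unique-xs , λ where
  (here refl) → All.head (++⁻ʳ xs x∉) refl
  (there y∈)  → y∉xs y∈

⊆⊎∃∉ : ∀ {m} (p q : Subset m) → p ⊆ q ⊎ ∃ λ x → x ∈ p × x ∉ q
⊆⊎∃∉ p q with any? (λ x → (x ∈? p) ×-dec ¬? (x ∈? q))
... | yes escape = inj₂ escape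
... | no none    = inj₁ λ {x} x∈p → decidable-stable (x ∈? q) (λ x∉q → none (x , x∈p , x∉q))

module WalkProperties (Γ : Graph)
  (E-sym : ∀ {u v} → E Γ u v → E Γ v u) (E⇒Vtx : ∀ {u v} → E Γ u v → Vtx Γ u) where

  private
    variable
      x y z : V Γ
      j k d : ℕ

  snocʷ : Walk Γ x y k → E Γ y z → Walk Γ x z (suc k)
  snocʷ (nil _)     e = cons e (nil (E⇒Vtx (E-sym e)))
  snocʷ (cons e′ w) e = cons e′ (snocʷ w e)

  reverseʷ : Walk Γ x y k → Walk Γ y x k
  reverseʷ (nil p)    = nil p
  reverseʷ (cons e w) = snocʷ (reverseʷ w) (E-sym e)

  IsDist-sym : IsDist Γ x y d → IsDist Γ y x d
  IsDist-sym (w , shortest) = reverseʷ w , λ k w′ → shortest k (reverseʷ w′)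

  visits : Walk Γ x y k → List (V Γ)
  visits (nil _)              = []
  visits (cons {w = w} _ rest) = w ∷ visits rest

  length-visits : (w : Walk Γ x y k) → length (visits w) ≡ k
  length-visits (nil _)     = refl
  length-visits (cons _ w) = cong suc (length-visits w)

  final-visits : (w : Walk Γ x y k) → final x (visits w) ≡ y
  final-visits (nil _)     = refl
  final-visits (cons _ w) = final-visits w

  Chain-visits : (w : Walk Γ x y k) → Chain Γ (x ∷ visits w)
  Chain-visits (nil _)               = tt
  Chain-visits (cons e (nil _))      = e , tt
  Chain-visits (cons e w@(cons _ _)) = e , Chain-visits w

  suffix-from : (w : Walk Γ x y k) → z ∈ₗ visits w → ∃ λ j → j < k × Walk Γ z y j
  suffix-from (cons _ w) (here refl) = _ , ≤-refl , w
  suffix-from (cons _ w) (there z∈) with suffix-from w z∈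
  ... | j , j<k , w′ = j , m<n⇒m<1+n j<k , w′

  Chain-++ : ∀ {a b} s t → Chain Γ (a ∷ s) → E Γ (final a s) b → Chain Γ (b ∷ t) → Chain Γ (a ∷ s ++ b ∷ t)
  Chain-++ []      t _             e chain = e , chain
  Chain-++ (_ ∷ s) t (e′ , chain′) e chain = e′ , Chain-++ s t chain′ e chain

  Chain-prefix : ∀ xs {ys} → Chain Γ (xs ++ ys) → Chain Γ xs
  Chain-prefix []           _           = tt
  Chain-prefix (_ ∷ [])     _           = tt
  Chain-prefix (_ ∷ y ∷ xs) (e , chain) = e , Chain-prefix (y ∷ xs) chain

  record Geodesic (x y : V Γ) : Set where
    field
      second    : V Γ
      remaining : ℕ
      first     : E Γ x second
      rest      : Walk Γ second y remaining
      shortest  : ∀ {k} → Walk Γ x y k → suc remaining ≤ k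

  geodesic : IsDist Γ x y d → x ≢ y → Σ (Geodesic x y) λ g → suc (Geodesic.remaining g) ≡ d
  geodesic (nil _ , _)           x≢y = ⊥-elim (x≢y refl)
  geodesic (cons e w , shortest) _   =
    record { first = e ; rest = w ; shortest = λ {k} → shortest k } , refl

  module Paths (_≟_ : DecidableEquality (V Γ)) where

    open DecMembership _≟_ using () renaming (_∈?_ to _∈ₗ?_)

    shortcut : (w : Walk Γ x y k) → Unique (x ∷ visits w) ⊎ ∃ λ j → j < k × Walk Γ x y j
    shortcut (nil _) = inj₁ ([] ∷ [])
    shortcut {x = x} (cons e w) with shortcut w
    ... | inj₂ (j , j<k , w′) = inj₂ (suc j , s≤s j<k , cons e w′)
    ... | inj₁ unique with x ∈ₗ? visits (cons e w)
    ...   | yes x∈ = inj₂ (suffix-from (cons e w) x∈)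
    ...   | no x∉  = inj₁ (¬Any⇒All¬ _ x∉ ∷ unique)

    to-path : Walk Γ x y k → ∃ λ j → j ≤ k × Σ (Walk Γ x y j) λ w → Unique (x ∷ visits w)
    to-path w = go (<-wellFounded _) w
      where
      go : ∀ {k} → Acc _<_ k → Walk Γ x y k → ∃ λ j → j ≤ k × Σ (Walk Γ x y j) λ w → Unique (x ∷ visits w)
      go (acc shorter) w with shortcut w
      ... | inj₁ unique = _ , ≤-refl , w , unique
      ... | inj₂ (j , j<k , w′) with go (shorter j<k) w′
      ...   | i , i≤j , path , unique = i , ≤-trans i≤j (≤-trans (n≤1+n j) j<k) , path , unique

    shortest-is-path : (w : Walk Γ x y k) → (∀ {j} → Walk Γ x y j → k ≤ j) → Unique (x ∷ visits w)
    shortest-is-path w shortest with shortcut w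
    ... | inj₁ unique          = unique
    ... | inj₂ (j , j<k , w′) = ⊥-elim (<⇒≱ j<k (shortest w′))

    IsPath : V Γ → List (V Γ) → V Γ → Set
    IsPath x t y = Chain Γ (x ∷ t) × Unique (x ∷ t) × final x t ≡ y

    module Acyclic (acyclic : ¬ HasCycle Γ) where

      -- Here x, b ∷ t is a path to y.  Given another path x, a, … to y with a ≠ b, scan walks
      -- along it: c is the current vertex and back the part already traversed, reversed, so it
      -- ends in x.  At the first c lying on b ∷ t, back followed by the part of b ∷ t before c
      -- closes a cycle through c; Started ensures that this cycle has at least three vertices.
      module Divergence {x b y : V Γ} {t : List (V Γ)} (x—b : E Γ x b) (path : IsPath b t y) where

        Started : V Γ → List (V Γ) → Set
        Started c back = 2 ≤ length back ⊎ (back ≡ [ x ] × c ≢ b)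

        close-cycle : ∀ {c back} qi rest → b ∷ t ≡ qi ++ c ∷ rest →
          Chain Γ (c ∷ back) → Unique (c ∷ back) → final c back ≡ x → Disjoint back (b ∷ t) →
          Started c back → HasCycle Γ
        close-cycle {c} {back} qi rest t≡ chain unique final≡x back#t started =
          c , back ++ qi , long qi t≡ started , Unique.++⁺ unique (proj₁ prefix) back#qi , vertex back chain started , cycle
          where
          prefix : Unique qi × c ∉ₗ qi
          prefix = Unique-++-∷⁻ qi (subst Unique t≡ (proj₁ (proj₂ path)))

          back#qi : Disjoint (c ∷ back) qi
          back#qi (here refl , v∈qi) = proj₂ prefix v∈qi
          back#qi (there v∈back , v∈qi) = back#t (v∈back , subst (_ ∈ₗ_) (sym t≡) (∈-++⁺ˡ v∈qi))

          long : ∀ qi → b ∷ t ≡ qi ++ c ∷ rest → Started c back → 2 ≤ length (back ++ qi)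
          long qi      _  (inj₁ two≤)         = ≤-trans two≤ (length-++-≤ˡ back)
          long []      t≡ (inj₂ (refl , c≢b)) = ⊥-elim (c≢b (sym (∷-injectiveˡ t≡)))
          long (_ ∷ _) _  (inj₂ (refl , _))   = s≤s (s≤s z≤n)

          vertex : ∀ back → Chain Γ (c ∷ back) → Started c back → Vtx Γ c
          vertex [] _ (inj₁ ())
          vertex [] _ (inj₂ (() , _))
          vertex (_ ∷ _) (e , _) _ = E⇒Vtx e

          rearrange : c ∷ back ++ b ∷ t ≡ (c ∷ (back ++ qi) ++ [ c ]) ++ rest
          rearrange = begin
            c ∷ back ++ b ∷ t                ≡⟨ cong (λ l → c ∷ back ++ l) t≡ ⟩
            c ∷ back ++ qi ++ c ∷ rest       ≡⟨ cong (c ∷_) (sym (++-assoc back qi (c ∷ rest))) ⟩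
            c ∷ (back ++ qi) ++ [ c ] ++ rest ≡⟨ cong (c ∷_) (sym (++-assoc (back ++ qi) [ c ] rest)) ⟩
            c ∷ ((back ++ qi) ++ [ c ]) ++ rest ∎
            where open ≡-Reasoning

          cycle : Chain Γ (c ∷ (back ++ qi) ++ [ c ])
          cycle = Chain-prefix (c ∷ (back ++ qi) ++ [ c ]) (subst (Chain Γ) rearrange
            (Chain-++ back t chain (subst (λ v → E Γ v b) (sym final≡x) x—b) (proj₁ path)))

        scan : ∀ c back ahead → Chain Γ (c ∷ back) → Unique (c ∷ back) → final c back ≡ x →
          Disjoint back (b ∷ t) → Started c back → IsPath c ahead y → Disjoint back (c ∷ ahead) → HasCycle Γ
        scan c back [] chain unique final≡x back#t started (_ , _ , refl) _ =
          let qi , rest , t≡ = ∈-∃++ (subst (_∈ₗ b ∷ t) (proj₂ (proj₂ path)) (final∈ b t))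
          in close-cycle qi rest t≡ chain unique final≡x back#t started
        scan c back (c′ ∷ ahead) chain unique final≡x back#t started
             ((c—c′ , chain′) , c∉ ∷ unique′ , final′) back#ahead with c ∈ₗ? b ∷ t
        ... | yes c∈t = let qi , rest , t≡ = ∈-∃++ c∈t
                        in close-cycle qi rest t≡ chain unique final≡x back#t started
        ... | no c∉t  = scan c′ (c ∷ back) ahead (E-sym c—c′ , chain) (¬Any⇒All¬ _ c′∉ ∷ unique) final≡x
                          c∷back#t (inj₁ (s≤s (nonempty started))) (chain′ , unique′ , final′) c∷back#ahead
          where
          c′∉ : c′ ∉ₗ c ∷ back
          c′∉ (here c′≡c)  = All.head c∉ (sym c′≡c)
          c′∉ (there c′∈) = back#ahead (c′∈ , there (here refl))

          c∷back#t : Disjoint (c ∷ back) (b ∷ t)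
          c∷back#t (here refl , v∈t)    = c∉t v∈t
          c∷back#t (there v∈back , v∈t) = back#t (v∈back , v∈t)

          c∷back#ahead : Disjoint (c ∷ back) (c′ ∷ ahead)
          c∷back#ahead (here refl , v∈)    = Unique.Unique[x∷xs]⇒x∉xs (c∉ ∷ unique′) v∈
          c∷back#ahead (there v∈back , v∈) = back#ahead (v∈back , there v∈)

          nonempty : Started c back → 1 ≤ length back
          nonempty (inj₁ two≤)      = ≤-trans (n≤1+n 1) two≤
          nonempty (inj₂ (refl , _)) = s≤s z≤n

      paths-unique : ∀ {x y} s t → IsPath x s y → IsPath x t y → s ≡ t
      paths-unique []      []      _ _ = refl
      paths-unique []      (b ∷ t) (_ , _ , refl) (_ , unique , final≡x) =
        ⊥-elim (Unique.Unique[x∷xs]⇒x∉xs unique (subst (_∈ₗ b ∷ t) final≡x (final∈ b t)))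
      paths-unique (a ∷ s) []      (_ , unique , final≡x) (_ , _ , refl) =
        ⊥-elim (Unique.Unique[x∷xs]⇒x∉xs unique (subst (_∈ₗ a ∷ s) final≡x (final∈ a s)))
      paths-unique {x} (a ∷ s) (b ∷ t) ((x—a , chain-s) , x∉s ∷ unique-s , final-s)
                                       ((x—b , chain-t) , x∉t ∷ unique-t , final-t) with a ≟ b
      ... | yes refl = cong (a ∷_) (paths-unique s t (chain-s , unique-s , final-s) (chain-t , unique-t , final-t))
      ... | no a≢b   = ⊥-elim (acyclic (Divergence.scan x—b (chain-t , unique-t , final-t)
                         a [ x ] s (E-sym x—a , tt) ((a≢x ∷ []) ∷ [] ∷ []) refl x#t (inj₂ (refl , a≢b))
                         (chain-s , unique-s , final-s) x#s))
        where
        a≢x : a ≢ x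
        a≢x a≡x = All.head x∉s (sym a≡x)

        x#t : Disjoint [ x ] (b ∷ t)
        x#t (here refl , x∈t) = Unique.Unique[x∷xs]⇒x∉xs (x∉t ∷ unique-t) x∈t

        x#s : Disjoint [ x ] (a ∷ s)
        x#s (here refl , x∈s) = Unique.Unique[x∷xs]⇒x∉xs (x∉s ∷ unique-s) x∈s

      detour : ∀ {A B X} (g : Geodesic A B) → E Γ X A → X ≢ A → X ≢ Geodesic.second g →
        ∀ {q} → Walk Γ X B q → 2 + Geodesic.remaining g ≤ q
      detour {A} {B} {X} g X—A X≢A X≢second w with to-path w
      ... | j , j≤q , w′ , unique-w′ = ≤-trans (≤-reflexive same-length) j≤q
        where
        open Geodesic g

        X∉rest : X ∉ₗ visits rest
        X∉rest X∈ with suffix-from rest X∈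
        ... | i , i<remaining , w″ = <⇒≱ (s≤s i<remaining) (shortest (cons (E-sym X—A) w″))

        X∉ : X ∉ₗ A ∷ second ∷ visits rest
        X∉ (here X≡A)               = X≢A X≡A
        X∉ (there (here X≡second))  = X≢second X≡second
        X∉ (there (there X∈rest))   = X∉rest X∈rest

        via-A : IsPath X (A ∷ second ∷ visits rest) B
        via-A = (X—A , first , Chain-visits rest) , ¬Any⇒All¬ _ X∉ ∷ shortest-is-path (cons first rest) shortest ,
                final-visits rest

        same-length : 2 + remaining ≡ j
        same-length = begin
          2 + remaining                        ≡⟨ cong (2 +_) (sym (length-visits rest)) ⟩
          length (A ∷ second ∷ visits rest)    ≡⟨ cong length (paths-unique _ _ via-A (Chain-visits w′ , unique-w′ , final-visits w′)) ⟩
          length (visits w′)                   ≡⟨ length-visits w′ ⟩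
          j                                    ∎
          where open ≡-Reasoning

  module Distance (_≟_ : DecidableEquality (V Γ)) (Vtx? : Decidable (Vtx Γ)) (E? : ∀ u v → Dec (E Γ u v))
    (∃? : {P : V Γ → Set} → Decidable P → Dec (∃ P)) where

    walk? : ∀ k u v → Dec (Walk Γ u v k)
    walk? zero u v with u ≟ v | Vtx? u
    ... | yes refl | yes u∈ = yes (nil u∈)
    ... | yes refl | no u∉  = no λ { (nil u∈) → u∉ u∈ }
    ... | no u≢v   | _      = no λ { (nil _) → u≢v refl }
    walk? (suc k) u v = map′ (λ (_ , e , w) → cons e w) (λ { (cons e w) → _ , e , w })
                             (∃? λ w → E? u w ×-dec walk? k w v)

    distance : Connected Γ → ∀ {u v} → Vtx Γ u → Vtx Γ v → ∃ (IsDist Γ u v)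
    distance (_ , connected) {u} {v} u∈ v∈ with least-witness (λ k → walk? k u v) (proj₂ (connected u v u∈ v∈))
    ... | d , w , least = d , w , λ _ w′ → least w′

module Cliques (G : SimpleGraph) where

  private
    variable
      u v w x : Fin (n G)
      A B C X Y : Subset (n G)
      j k d : ℕ

  Adj-sym : Adj G u v → Adj G v u
  Adj-sym {u} {v} a = trans (symm G v u) a

  _≟ˢ_ : DecidableEquality (Subset (n G))
  _≟ˢ_ = ≡-dec _≟ᵇ_

  isClique? : Decidable (IsClique G)
  isClique? S = nonempty? S ×-dec all? λ x → all? λ y →
    (x ∈? S) →-dec (y ∈? S) →-dec ¬? (x ≟ᶠ y) →-dec (adj G x y ≟ᵇ true)

  no-proper-extension⇒maximal : ∀ {S} → IsClique G S → ¬ (∃ λ T → IsClique G T × S ⊂ T) → IsMaximalClique G S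
  no-proper-extension⇒maximal {S} cS none = cS , maximal
    where
    maximal : ∀ T → IsClique G T → S ⊆ T → T ≡ S
    maximal T cT S⊆T with ⊆⊎∃∉ T S
    ... | inj₁ T⊆S   = ⊆-antisym T⊆S S⊆T
    ... | inj₂ escape = ⊥-elim (none (T , cT , S⊆T , escape))

  isMaximalClique? : Decidable (IsMaximalClique G)
  isMaximalClique? S with isClique? S | anySubset? (λ T → isClique? T ×-dec S ⊂? T)
  ... | no ¬cS | _  = no (¬cS ∘ proj₁)
  ... | yes cS | no none = yes (no-proper-extension⇒maximal cS none)
  ... | yes _  | yes (T , cT , S⊆T , x , x∈T , x∉S) =
    no λ (_ , maximal) → x∉S (subst (x ∈_) (maximal T cT S⊆T) x∈T)

  extend-to-maximal : ∀ fuel {S} → IsClique G S → n G ≤ ∣ S ∣ + fuel → ∃ λ C → IsMaximalClique G C × S ⊆ C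
  extend-to-maximal fuel {S} cS bound with anySubset? (λ T → isClique? T ×-dec S ⊂? T)
  ... | no none = S , no-proper-extension⇒maximal cS none , id
  extend-to-maximal zero {S} _ bound | yes (T , _ , S⊂T) =
    ⊥-elim (<⇒≱ (p⊂q⇒∣p∣<∣q∣ S⊂T) (≤-trans (∣p∣≤n T) (≤-trans bound (≤-reflexive (+-identityʳ ∣ S ∣)))))
  extend-to-maximal (suc fuel) {S} _ bound | yes (T , cT , S⊂T)
    with extend-to-maximal fuel cT (≤-trans bound (≤-trans (≤-reflexive (+-suc ∣ S ∣ fuel)) (+-monoˡ-≤ fuel (p⊂q⇒∣p∣<∣q∣ S⊂T))))
  ... | C , mC , T⊆C = C , mC , T⊆C ∘ proj₁ S⊂T

  clique-through : u ≡ w ⊎ Adj G u w → ∃ λ C → IsMaximalClique G C × u ∈ C × w ∈ C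
  clique-through {u} {w} u~w with extend-to-maximal (n G) ((u , u∈pair) , pair-clique) (m≤n+m (n G) _)
    where
    u∈pair : u ∈ ⁅ u ⁆ ∪ ⁅ w ⁆
    u∈pair = x∈p∪q⁺ (inj₁ (x∈⁅x⁆ u))

    ∈-pair : x ∈ ⁅ u ⁆ ∪ ⁅ w ⁆ → x ≡ u ⊎ x ≡ w
    ∈-pair x∈ with x∈p∪q⁻ ⁅ u ⁆ ⁅ w ⁆ x∈
    ... | inj₁ x∈u = inj₁ (x∈⁅y⁆⇒x≡y u x∈u)
    ... | inj₂ x∈w = inj₂ (x∈⁅y⁆⇒x≡y w x∈w)

    adjacent : u ≡ w ⊎ Adj G u w → u ≢ w → Adj G u w
    adjacent (inj₁ u≡w) u≢w = ⊥-elim (u≢w u≡w)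
    adjacent (inj₂ a)   _   = a

    pair-clique : ∀ x y → x ∈ ⁅ u ⁆ ∪ ⁅ w ⁆ → y ∈ ⁅ u ⁆ ∪ ⁅ w ⁆ → x ≢ y → Adj G x y
    pair-clique x y x∈ y∈ x≢y with ∈-pair x∈ | ∈-pair y∈
    ... | inj₁ refl | inj₁ refl = ⊥-elim (x≢y refl)
    ... | inj₁ refl | inj₂ refl = adjacent u~w x≢y
    ... | inj₂ refl | inj₁ refl = Adj-sym (adjacent u~w (x≢y ∘ sym))
    ... | inj₂ refl | inj₂ refl = ⊥-elim (x≢y refl)
  ... | C , mC , pair⊆C = C , mC , pair⊆C (x∈p∪q⁺ (inj₁ (x∈⁅x⁆ u))) , pair⊆C (x∈p∪q⁺ (inj₂ (x∈⁅x⁆ w)))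

  Adj-in-clique : IsMaximalClique G C → u ∈ C → v ∈ C → u ≢ v → Adj G u v
  Adj-in-clique ((_ , clique) , _) = clique _ _

  intersecting : IsMaximalClique G A → IsMaximalClique G B → A ≢ B → x ∈ A → x ∈ B → E (cliqueGraph G) A B
  intersecting mA mB A≢B x∈A x∈B = mA , mB , A≢B , _ , x∈p∩q⁺ (x∈A , x∈B)

  intersecting-sym : E (cliqueGraph G) A B → E (cliqueGraph G) B A
  intersecting-sym {A} {B} (mA , mB , A≢B , x , x∈A∩B) =
    mB , mA , A≢B ∘ sym , x , x∈p∩q⁺ (proj₂ (x∈p∩q⁻ A B x∈A∩B) , proj₁ (x∈p∩q⁻ A B x∈A∩B))

  intersecting? : ∀ A B → Dec (E (cliqueGraph G) A B)
  intersecting? A B = isMaximalClique? A ×-dec isMaximalClique? B ×-dec ¬? (A ≟ˢ B) ×-dec nonempty? (A ∩ B)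

  leaving-vertex : E (cliqueGraph G) A B → ∃ λ u → u ∈ A × u ∉ B
  leaving-vertex {A} {B} ((_ , maximal) , (cB , _) , A≢B , _) with ⊆⊎∃∉ A B
  ... | inj₁ A⊆B   = ⊥-elim (A≢B (sym (maximal B cB A⊆B)))
  ... | inj₂ escape = escape

  module WalkG = WalkProperties (toGraph G) Adj-sym (λ _ → tt)
  module WalkΓ = WalkProperties (cliqueGraph G) intersecting-sym proj₁
  module DistanceG = WalkG.Distance _≟ᶠ_ (λ _ → yes tt) (λ u v → adj G u v ≟ᵇ true) any?
  module DistanceΓ = WalkΓ.Distance _≟ˢ_ isMaximalClique? intersecting? anySubset?

  clique-walk⇒walk : Walk (cliqueGraph G) A B k → u ∈ A → v ∈ B → ∃ λ j → j ≤ suc k × Walk (toGraph G) u v j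
  clique-walk⇒walk {u = u} {v} (nil mA) u∈A v∈A with u ≟ᶠ v
  ... | yes refl = 0 , z≤n , nil tt
  ... | no u≢v   = 1 , ≤-refl , cons (Adj-in-clique mA u∈A v∈A u≢v) (nil tt)
  clique-walk⇒walk {A} {u = u} (cons {w = C} (mA , _ , _ , x , x∈A∩C) p) u∈A v∈B
    with clique-walk⇒walk p (proj₂ (x∈p∩q⁻ A C x∈A∩C)) v∈B | u ≟ᶠ x
  ... | j , j≤ , w | yes refl = j , m≤n⇒m≤1+n j≤ , w
  ... | j , j≤ , w | no u≢x   = suc j , s≤s j≤ , cons (Adj-in-clique mA u∈A (proj₁ (x∈p∩q⁻ A C x∈A∩C)) u≢x) w

  walk⇒clique-walk : IsMaximalClique G X → u ∈ X → Walk (toGraph G) u v k →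
    ∃ λ Y → IsMaximalClique G Y × v ∈ Y × ∃ λ j → j ≤ k × Walk (cliqueGraph G) X Y j
  walk⇒clique-walk mX u∈X (nil _) = _ , mX , u∈X , 0 , z≤n , nil mX
  walk⇒clique-walk {X} mX u∈X (cons a w) with clique-through (inj₂ a)
  ... | Z , mZ , u∈Z , next∈Z with walk⇒clique-walk mZ next∈Z w
  ... | Y , mY , v∈Y , j , j≤k , p with X ≟ˢ Z
  ...   | yes refl = Y , mY , v∈Y , j , m≤n⇒m≤1+n j≤k , p
  ...   | no X≢Z   = Y , mY , v∈Y , suc j , s≤s j≤k , cons (intersecting mX mZ X≢Z u∈X u∈Z) p

  step-into : Walk (cliqueGraph G) X Y j → IsMaximalClique G Y → IsMaximalClique G B → v ∈ Y → v ∈ B →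
    ∃ λ q → q ≤ suc j × Walk (cliqueGraph G) X B q
  step-into {Y = Y} {j} {B} p mY mB v∈Y v∈B with Y ≟ˢ B
  ... | yes refl = j , n≤1+n j , p
  ... | no Y≢B   = suc j , ≤-refl , WalkΓ.snocʷ p (intersecting mY mB Y≢B v∈Y v∈B)

  clique-distance-≥ : ∀ {D} → (∀ k → Walk (toGraph G) u v k → D ≤ k) → u ∈ A → v ∈ B →
    Walk (cliqueGraph G) A B k → D ∸ 1 ≤ k
  clique-distance-≥ shortest u∈A v∈B p with clique-walk⇒walk p u∈A v∈B
  ... | j , j≤ , w = ∸-monoˡ-≤ 1 (≤-trans (shortest j w) j≤)

  diameter-exists : Connected (toGraph G) → ∃ (IsDiam (toGraph G))
  diameter-exists connected@((x₀ , _) , _) = from-farthest (maximum-pair (λ u v → proj₁ (dist u v)) x₀)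
    where
    dist : ∀ u v → ∃ (IsDist (toGraph G) u v)
    dist u v = DistanceG.distance connected tt tt

    from-farthest : (∃₂ λ u₀ v₀ → ∀ u v → proj₁ (dist u v) ≤ proj₁ (dist u₀ v₀)) → ∃ (IsDiam (toGraph G))
    from-farthest (u₀ , v₀ , farthest) =
      proj₁ (dist u₀ v₀) , (λ u v _ _ → proj₁ (dist u v) , proj₂ (dist u v) , farthest u v) ,
      u₀ , v₀ , tt , tt , proj₂ (dist u₀ v₀)

  module Tree (acyclic : ¬ HasCycle (cliqueGraph G)) where

    open WalkΓ using (Geodesic; geodesic; IsDist-sym; reverseʷ)
    open WalkΓ.Paths.Acyclic _≟ˢ_ acyclic using (detour)

    -- A clique through u is A or, by detour, one step further from B than A is; symmetrically
    -- for v.  So cliques through u and through v are at least as far apart as A and B.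
    far-apart : IsMaximalClique G A → IsMaximalClique G B → A ≢ B → IsDist (cliqueGraph G) A B d →
      ∃₂ λ u v → ∀ k → Walk (toGraph G) u v k → suc d ≤ k
    far-apart {A} {B} mA mB A≢B dist with geodesic dist A≢B | geodesic (IsDist-sym dist) (A≢B ∘ sym)
    ... | g , refl | g′ , same-length with leaving-vertex (Geodesic.first g) | leaving-vertex (Geodesic.first g′)
    ... | u , u∈A , u∉second | v , v∈B , v∉second′ = u , v , bound
      where
      far : IsMaximalClique G X → IsMaximalClique G Y → u ∈ X → v ∈ Y →
        Walk (cliqueGraph G) X Y j → suc (Geodesic.remaining g) ≤ j
      far {X} {Y} mX mY u∈X v∈Y p with X ≟ˢ A | Y ≟ˢ B
      ... | no X≢A | _ with step-into p mY mB v∈Y v∈B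
      ...   | q , q≤ , p′ = ≤-pred (≤-trans (detour g (intersecting mX mA X≢A u∈X u∈A) X≢A
                              (λ { refl → u∉second u∈X }) p′) q≤)
      far mX mY u∈X v∈Y p | yes refl | yes refl = proj₂ dist _ p
      far mX mY u∈X v∈Y p | yes refl | no Y≢B =
        ≤-trans (≤-reflexive (sym same-length)) (≤-trans (n≤1+n _)
          (detour g′ (intersecting mY mB Y≢B v∈Y v∈B) Y≢B (λ { refl → v∉second′ v∈Y }) (reverseʷ p)))

      bound : ∀ k → Walk (toGraph G) u v k → suc (suc (Geodesic.remaining g)) ≤ k
      bound zero (nil _) with far mB mB v∈B v∈B (nil mB)
      ... | ()
      bound (suc k) (cons a w) with clique-through (inj₂ a)
      ... | X , mX , u∈X , next∈X with walk⇒clique-walk mX next∈X w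
      ... | Y , mY , v∈Y , j , j≤k , p = s≤s (≤-trans (far mX mY u∈X v∈Y p) j≤k)

    clique-distance-≤ : ∀ {D} → (∀ u v → ∃ λ k → k ≤ D × Walk (toGraph G) u v k) →
      IsMaximalClique G A → IsMaximalClique G B → IsDist (cliqueGraph G) A B d → d ≤ D ∸ 1
    clique-distance-≤ {A} {B} short mA mB dist with A ≟ˢ B
    ... | yes refl = ≤-trans (proj₂ dist 0 (nil mA)) z≤n
    ... | no A≢B with far-apart mA mB A≢B dist
    ...   | u , v , bound with short u v
    ...     | k , k≤D , w = ∸-monoˡ-≤ 1 (≤-trans (bound k w) k≤D)

    clique-graph-diameter : ∀ {D} → Connected (cliqueGraph G) → IsDiam (toGraph G) D → IsDiam (cliqueGraph G) (D ∸ 1)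
    clique-graph-diameter {D} connectedΓ (bounded , u₀ , v₀ , _ , _ , u₀v₀-far) =
      boundedΓ , realised (clique-through (inj₁ refl)) (clique-through (inj₁ refl))
      where
      short : ∀ u v → ∃ λ k → k ≤ D × Walk (toGraph G) u v k
      short u v with bounded u v tt tt
      ... | k , (w , _) , k≤D = k , k≤D , w

      boundedΓ : ∀ A B → IsMaximalClique G A → IsMaximalClique G B →
        Σ ℕ λ d → IsDist (cliqueGraph G) A B d × d ≤ D ∸ 1
      boundedΓ A B mA mB with DistanceΓ.distance connectedΓ mA mB
      ... | d , dist = d , dist , clique-distance-≤ short mA mB dist

      realised : (∃ λ A → IsMaximalClique G A × u₀ ∈ A × u₀ ∈ A) → (∃ λ B → IsMaximalClique G B × v₀ ∈ B × v₀ ∈ B) →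
        Σ (Subset (n G)) λ A → Σ (Subset (n G)) λ B →
          IsMaximalClique G A × IsMaximalClique G B × IsDist (cliqueGraph G) A B (D ∸ 1)
      realised (A , mA , u₀∈A , _) (B , mB , v₀∈B , _) with boundedΓ A B mA mB
      ... | d , dist , d≤ = A , B , mA , mB , subst (IsDist (cliqueGraph G) A B)
        (≤-antisym d≤ (clique-distance-≥ (proj₂ u₀v₀-far) u₀∈A v₀∈B (proj₁ dist))) dist

proposition3p7 : (G : SimpleGraph) → Connected (toGraph G) → IsTree (cliqueGraph G)
    → Σ ℕ λ D → Σ ℕ λ D' → IsDiam (toGraph G) D × IsDiam (cliqueGraph G) D' × D ∸ 1 ≡ D'
proposition3p7 G connected (connectedΓ , acyclic) = conclude (Cliques.diameter-exists G connected)
  where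
  conclude : ∃ (IsDiam (toGraph G)) →
    Σ ℕ λ D → Σ ℕ λ D' → IsDiam (toGraph G) D × IsDiam (cliqueGraph G) D' × D ∸ 1 ≡ D'
  conclude (D , diam) = D , D ∸ 1 , diam , Cliques.Tree.clique-graph-diameter G acyclic connectedΓ diam , refl
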